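{- For $k,m\in\mathbb{N}$, the number of distinct $k$-distance magic labelings of the labeled graph $\bigcup_{i=1}^m C_{4k}$ (the disjoint union of $m$ copies of the cycle $C_{4k}$, with labeled vertices) is $2^{2km}(2km)!$.
   Context: All graphs are finite, simple and undirected; $d(u,v)$ is graph distance ($\infty$ between different components). For $u\in V(G)$ and $k\in\mathbb{N}$, $\partial N_k(u)=\{v\in V(G): d(u,v)=k\}$. For a graph $G$ of order $n\ge3$, a $k$-distance magic labeling ($k$-DML) is a bijection $f:V(G)\to\{1,\dots,n\}$ such that $\sum_{w\in\partial N_k(u)} f(w)$ is a constant independent of $u\in V(G)$. Two labelings are distinct if they differ as functions on the fixed labeled vertex set. -}

module Defs where

open import Data.Nat using (ℕ; zero; suc; _+_; _*_; _∸_; _<_; _≤_; _≡ᵇ_)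
open import Data.Fin using (Fin; toℕ; remQuot)
open import Data.Fin.Properties using () renaming (_≟_ to _≟ᶠ_)
open import Data.Bool using (Bool; true; false; _∧_; _∨_; not; if_then_else_)
open import Data.List using (List; allFin; map; upTo; length)
open import Data.Bool.ListAction using (any)
open import Data.Nat.ListAction using (sum)
open import Data.Vec using (Vec; lookup)
open import Data.Product using (Σ; _×_; _,_; proj₁; proj₂; ∃)
open import Relation.Nullary.Decidable using (⌊_⌋)
open import Relation.Binary.PropositionalEquality using (_≡_)
open import Data.List.Relation.Unary.Unique.Propositional using (Unique)
open import Data.List.Membership.Propositional using (_∈_)
open import Function.Bundles using (_⇔_)

record Graph : Set where
  field
    order : ℕ
    adj   : Fin order → Fin order → Bool
open Graph public

module _ (G : Graph) where
  private
    V = Fin (order G)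

  walk : ℕ → V → V → Bool
  walk zero    u v = ⌊ u ≟ᶠ v ⌋
  walk (suc ℓ) u v = any (λ w → adj G u w ∧ walk ℓ w v) (allFin (order G))

  -- graph distance: d(u,v) = k  iff there is a walk of length k from u
  -- to v and no walk of any length j < k.  (If u,v lie in different
  -- components, this is false for every k, i.e. d(u,v) = ∞.)
  distIs : V → V → ℕ → Bool
  distIs u v k = walk k u v ∧ not (any (λ j → walk j u v) (upTo k))

  sphereSum : ℕ → Vec ℕ (order G) → V → ℕ
  sphereSum k f u =
    sum (map (λ w → if distIs u w k then lookup f w else 0) (allFin (order G)))

  IsBijLabeling : Vec ℕ (order G) → Set
  IsBijLabeling f =
    (∀ v → 1 ≤ lookup f v × lookup f v ≤ order G)
    × (∀ u v → lookup f u ≡ lookup f v → u ≡ v)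
    × (∀ j → 1 ≤ j → j ≤ order G → ∃ λ v → lookup f v ≡ j)

  IsKDML : ℕ → Vec ℕ (order G) → Set
  IsKDML k f = IsBijLabeling f × ∃ λ c → ∀ u → sphereSum k f u ≡ c

  NumKDML : ℕ → ℕ → Set
  NumKDML k N =
    Σ (List (Vec ℕ (order G))) λ L →
      Unique L × (∀ f → (f ∈ L) ⇔ IsKDML k f) × length L ≡ N

succMod : (p : ℕ) → ℕ → ℕ
succMod p i = if (suc i ≡ᵇ p) then 0 else suc i

cycleAdj : (p : ℕ) → Fin p → Fin p → Bool
cycleAdj p a b = (succMod p (toℕ a) ≡ᵇ toℕ b) ∨ (succMod p (toℕ b) ≡ᵇ toℕ a)

-- Disjoint union of m copies of C_p; vertex x ∈ Fin (m * p) is vertex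
-- (remQuot x).2 of copy (remQuot x).1.
unionCycles : (m p : ℕ) → Graph
unionCycles m p = record
  { order = m * p
  ; adj   = λ x y →
      let (i , a) = remQuot {m} p x
          (j , b) = remQuot {m} p y
      in ⌊ i ≟ᶠ j ⌋ ∧ cycleAdj p a b
  }

module Submission where

-- In a copy of C₄ₖ the vertices at distance k from u are u + k and u + 3k = u − k. So, with
-- σ v = v + 2k (a fixed-point-free involution), a bijective labelling f is k-distance magic iff
-- f v + f (σ v) is a constant c, and comparing the vertices labelled 1 and n shows c = n + 1.
-- Such a labelling amounts to matching the N = 2km orbits {v, σ v} with the N label pairs
-- {a, n + 1 − a} (N! ways) and orienting each pair (2ᴺ ways). The labellings are enumerated
-- through the labels of one chosen point per orbit, each a signed representative of its pair.

open import Defs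
open import Data.Nat
open import Data.Nat.Properties
open import Data.Nat.DivMod
open import Data.Nat.Divisibility using (_∣_; divides)
open import Data.Nat.ListAction using (sum)
open import Data.Nat.Tactic.RingSolver using (solve-∀)
open import Data.Bool using (Bool; true; false; not; T; _∧_; _∨_; if_then_else_)
open import Data.Bool.Properties using (T-∧; T-∨; T-≡; T-not-≡; if-cong)
open import Data.Bool.ListAction using (any)
open import Data.Fin using (Fin; toℕ; fromℕ<; combine; remQuot)
import Data.Fin as Fin
import Data.Fin.Properties as Finₚ
open import Data.Fin.Properties using (toℕ<n; toℕ-fromℕ<; toℕ-injective; remQuot-combine; combine-remQuot)
open import Data.Vec using (Vec; lookup) renaming (tabulate to tabulateᵛ)
open import Data.Vec.Properties using (lookup∘tabulate; tabulate∘lookup)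
  renaming (tabulate-cong to tabulateᵛ-cong)
open import Data.List
  using (List; []; _∷_; [_]; map; _++_; concatMap; length; head; applyUpTo; tabulate; allFin; upTo)
open import Data.List.Properties
  using (length-++; length-map; map-∘; ∷-injectiveˡ; ∷-injectiveʳ; length-applyUpTo; map-tabulate)
open import Data.List.Membership.Propositional using (_∈_; find; lose)
open import Data.List.Membership.Propositional.Properties
  using (∈-map⁺; ∈-map⁻; ∈-++⁺ˡ; ∈-++⁺ʳ; ∈-++⁻; ∈-concatMap⁺; ∈-concatMap⁻; ∈-∃++;
         ∈-applyUpTo⁺; ∈-applyUpTo⁻; ∈-tabulate⁺; ∈-tabulate⁻; ∈-allFin; ∈-upTo⁺; ∈-upTo⁻)
open import Data.List.Relation.Unary.Any using (here; there)
open import Data.List.Relation.Unary.Any.Properties using (any⁺; any⁻)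
open import Data.List.Relation.Unary.All as All using (All; []; _∷_)
import Data.List.Relation.Unary.All.Properties as All
open import Data.List.Relation.Unary.AllPairs using ([]; _∷_)
open import Data.List.Relation.Unary.Unique.Propositional using (Unique)
import Data.List.Relation.Unary.Unique.Propositional.Properties as Unique
open import Data.List.Relation.Binary.Subset.Propositional using (_⊆_)
open import Data.List.Relation.Binary.Permutation.Propositional
  using (_↭_; ↭-refl; ↭-prep; ↭-swap; ↭-trans; ↭-sym; ↭⇒↭ₛ)
open import Data.List.Relation.Binary.Permutation.Propositional.Properties
  using (∈-resp-↭; All-resp-↭; ↭-length; drop-∷; ¬x∷xs↭[]) renaming (shift to ↭-shift)
import Data.List.Relation.Binary.Permutation.Setoid.Properties as Permutationₛ
open import Data.Maybe using (just)
import Data.Maybe as Maybe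
open import Data.Maybe.Properties using (just-injective)
open import Data.Product using (Σ; ∃; ∃₂; _×_; _,_; proj₁; proj₂; map₂)
open import Data.Sum as Sum using (_⊎_; inj₁; inj₂)
open import Data.Unit using (tt)
open import Data.Empty using (⊥-elim)
open import Function using (_∘_; id)
open import Function.Bundles using (_⇔_; mk⇔; Equivalence)
open import Function.Properties.Equivalence using () renaming (trans to ⇔-trans)
open import Relation.Nullary using (¬_; yes; no)
open import Relation.Nullary.Decidable using (⌊_⌋; toWitness; fromWitness)
open import Relation.Binary.PropositionalEquality
  using (_≡_; _≢_; refl; sym; trans; cong; cong₂; subst; setoid; module ≡-Reasoning)

-- Selections, permutations and uniqueness of lists

module _ {a} {A : Set a} where

  Unique-resp-↭ : ∀ {xs ys : List A} → xs ↭ ys → Unique xs → Unique ys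
  Unique-resp-↭ p = Permutationₛ.Unique-resp-↭ (setoid A) (↭⇒↭ₛ p)

  Unique⇒↭ : ∀ {xs ys : List A} → Unique xs → Unique ys → xs ⊆ ys → ys ⊆ xs → xs ↭ ys
  Unique⇒↭ {[]}     {[]}    _ _ _ _ = ↭-refl
  Unique⇒↭ {[]}     {_ ∷ _} _ _ _ ys⊆xs with ys⊆xs (here refl)
  ... | ()
  Unique⇒↭ {x ∷ xs} (x∉xs ∷ uxs) uys xs⊆ys ys⊆xs
    with ys₁ , ys₂ , refl ← ∈-∃++ (xs⊆ys (here refl)) =
    ↭-trans (↭-prep x (Unique⇒↭ uxs urest xs⊆rest rest⊆xs)) (↭-sym ys↭)
    where
    ys↭ : ys₁ ++ [ x ] ++ ys₂ ↭ x ∷ ys₁ ++ ys₂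
    ys↭ = ↭-shift x ys₁ ys₂
    uxrest : Unique (x ∷ ys₁ ++ ys₂)
    uxrest = Unique-resp-↭ ys↭ uys
    urest : Unique (ys₁ ++ ys₂)
    urest = Unique.drop⁺ 1 uxrest
    xs⊆rest : xs ⊆ ys₁ ++ ys₂
    xs⊆rest z∈xs with ∈-resp-↭ ys↭ (xs⊆ys (there z∈xs))
    ... | here refl = ⊥-elim (All.lookup x∉xs z∈xs refl)
    ... | there z∈rest = z∈rest
    rest⊆xs : ys₁ ++ ys₂ ⊆ xs
    rest⊆xs z∈rest with ys⊆xs (∈-resp-↭ (↭-sym ys↭) (there z∈rest))
    ... | here refl = ⊥-elim (Unique.Unique[x∷xs]⇒x∉xs uxrest z∈rest)
    ... | there z∈xs = z∈xs

  select : List A → List (A × List A)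
  select []       = []
  select (x ∷ xs) = (x , xs) ∷ map (map₂ (x ∷_)) (select xs)

  map-proj₁-select : ∀ xs → map proj₁ (select xs) ≡ xs
  map-proj₁-select []       = refl
  map-proj₁-select (x ∷ xs) = cong (x ∷_) (trans (sym (map-∘ (select xs))) (map-proj₁-select xs))

  length-select : ∀ xs → length (select xs) ≡ length xs
  length-select xs = trans (sym (length-map proj₁ (select xs))) (cong length (map-proj₁-select xs))

  select-↭ : ∀ {x rest} xs → (x , rest) ∈ select xs → xs ↭ x ∷ rest
  select-↭ (y ∷ ys) (here refl) = ↭-refl
  select-↭ (y ∷ ys) (there p) with (x , rest) , q , refl ← ∈-map⁻ (map₂ (y ∷_)) p =
    ↭-trans (↭-prep y (select-↭ ys q)) (↭-swap y x ↭-refl)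

  ∈-select : ∀ {x} xs → x ∈ xs → ∃ λ rest → (x , rest) ∈ select xs
  ∈-select (y ∷ ys) (here refl) = ys , here refl
  ∈-select (y ∷ ys) (there p) with rest , q ← ∈-select ys p =
    y ∷ rest , there (∈-map⁺ (map₂ (y ∷_)) q)

module _ {a b} {A : Set a} {B : Set b} where

  length-concatMap : ∀ (g : A → List B) K (xs : List A) →
    (∀ {x} → x ∈ xs → length (g x) ≡ K) → length (concatMap g xs) ≡ length xs * K
  length-concatMap g K []       _ = refl
  length-concatMap g K (x ∷ xs) h =
    trans (length-++ (g x)) (cong₂ _+_ (h (here refl)) (length-concatMap g K xs (h ∘ there)))

  -- Blocks g x are told apart by a key read off their elements.
  Unique-concatMap : ∀ {k} {K : Set k} (g : A → List B) (key : A → K) (keyOf : B → K) (xs : List A) →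
    Unique (map key xs) → (∀ {x} → x ∈ xs → Unique (g x)) →
    (∀ {x z} → x ∈ xs → z ∈ g x → keyOf z ≡ key x) → Unique (concatMap g xs)
  Unique-concatMap g key keyOf []       _         _  _  = []
  Unique-concatMap g key keyOf (x ∷ xs) (x∉ ∷ ux) ug hk =
    Unique.++⁺ (ug (here refl)) (Unique-concatMap g key keyOf xs ux (ug ∘ there) (hk ∘ there)) disjoint
    where
    disjoint : ∀ {z} → ¬ (z ∈ g x × z ∈ concatMap g xs)
    disjoint (z∈gx , z∈rest) with y , y∈xs , z∈gy ← find (∈-concatMap⁻ g {xs = xs} z∈rest) =
      All.lookup x∉ (∈-map⁺ key y∈xs) (trans (sym (hk (here refl) z∈gx)) (hk (there y∈xs) z∈gy))

  Unique-map-on : ∀ (g : A → B) xs → (∀ {x y} → x ∈ xs → y ∈ xs → g x ≡ g y → x ≡ y) →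
    Unique xs → Unique (map g xs)
  Unique-map-on g []       _   []         = []
  Unique-map-on g (x ∷ xs) inj (x∉ ∷ ux) =
    All.map⁺ (All.tabulate (λ y∈xs e → All.lookup x∉ y∈xs (inj (here refl) (there y∈xs) e))) ∷
    Unique-map-on g xs (λ p q → inj (there p) (there q)) ux

-- Signed arrangements of 1 … N

module SignedArrangements (N : ℕ) where

  open ≡-Reasoning

  n : ℕ
  n = N + N

  mirror : ℕ → ℕ
  mirror x = suc n ∸ x

  InRange : ℕ → Set
  InRange x = 1 ≤ x × x ≤ n

  Small : ℕ → Set
  Small c = 1 ≤ c × c ≤ N

  rep : ℕ → ℕ
  rep x with x ≤? N
  ... | yes _ = x
  ... | no  _ = mirror x

  N≤n : N ≤ n
  N≤n = m≤m+n N N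

  mirror-involutive : ∀ {x} → x ≤ n → mirror (mirror x) ≡ x
  mirror-involutive x≤n = m∸[m∸n]≡n (m≤n⇒m≤1+n x≤n)

  +-mirror : ∀ {x} → x ≤ n → x + mirror x ≡ suc n
  +-mirror x≤n = m+[n∸m]≡n (m≤n⇒m≤1+n x≤n)

  mirror-InRange : ∀ {x} → InRange x → InRange (mirror x)
  mirror-InRange (1≤x , x≤n) = m<n⇒0<n∸m (s≤s x≤n) , ∸-monoʳ-≤ (suc n) 1≤x

  mirror-small : ∀ {x} → x ≤ N → N < mirror x
  mirror-small x≤N = ≤-trans (≤-reflexive (sym (m+n∸n≡m (suc N) N))) (∸-monoʳ-≤ (suc n) x≤N)

  mirror-large : ∀ {x} → N < x → mirror x ≤ N
  mirror-large N<x = ≤-trans (∸-monoʳ-≤ (suc n) N<x) (≤-reflexive (m+n∸m≡n N N))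

  mirror-≢ : ∀ x → x ≢ mirror x
  mirror-≢ x x≡ with x ≤? N
  ... | yes x≤N = <⇒≢ (<-≤-trans (s≤s x≤N) (mirror-small x≤N)) x≡
  ... | no  x≰N = <⇒≢ (≤-<-trans (mirror-large (≰⇒> x≰N)) (≰⇒> x≰N)) (sym x≡)

  Small⇒InRange : ∀ {c} → Small c → InRange c
  Small⇒InRange (1≤c , c≤N) = 1≤c , ≤-trans c≤N N≤n

  rep-small : ∀ {x} → x ≤ N → rep x ≡ x
  rep-small {x} x≤N with x ≤? N
  ... | yes _   = refl
  ... | no  x≰N = ⊥-elim (x≰N x≤N)

  rep-large : ∀ {x} → N < x → rep x ≡ mirror x
  rep-large {x} N<x with x ≤? N
  ... | yes x≤N = ⊥-elim (<⇒≱ N<x x≤N)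
  ... | no  _   = refl

  rep-Small : ∀ {x} → InRange x → Small (rep x)
  rep-Small {x} x∈ with x ≤? N
  ... | yes x≤N = proj₁ x∈ , x≤N
  ... | no  x≰N = proj₁ (mirror-InRange x∈) , mirror-large (≰⇒> x≰N)

  rep-mirror : ∀ {x} → InRange x → rep (mirror x) ≡ rep x
  rep-mirror {x} (_ , x≤n) with x ≤? N
  ... | yes x≤N = trans (rep-large (mirror-small x≤N)) (mirror-involutive x≤n)
  ... | no  x≰N = rep-small (mirror-large (≰⇒> x≰N))

  rep-injective : ∀ {x y} → InRange x → InRange y → rep x ≡ rep y → x ≡ y ⊎ x ≡ mirror y
  rep-injective {x} {y} (_ , x≤n) (_ , y≤n) e with x ≤? N | y ≤? N
  ... | yes _ | yes _ = inj₁ e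
  ... | yes _ | no  _ = inj₂ e
  ... | no  _ | yes _ = inj₂ (trans (sym (mirror-involutive x≤n)) (cong mirror e))
  ... | no  _ | no  _ =
    inj₁ (trans (sym (mirror-involutive x≤n)) (trans (cong mirror e) (mirror-involutive y≤n)))

  mirrorIf : Bool → ℕ → ℕ
  mirrorIf false x = x
  mirrorIf true  x = mirror x

  mirrorIf-InRange : ∀ b {x} → InRange x → InRange (mirrorIf b x)
  mirrorIf-InRange false x∈ = x∈
  mirrorIf-InRange true  x∈ = mirror-InRange x∈

  rep-mirrorIf : ∀ b {x} → InRange x → rep (mirrorIf b x) ≡ rep x
  rep-mirrorIf false _  = refl
  rep-mirrorIf true  x∈ = rep-mirror x∈

  mirrorIf+mirrorIf-not : ∀ b {x} → x ≤ n → mirrorIf b x + mirrorIf (not b) x ≡ suc n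
  mirrorIf+mirrorIf-not false     x≤n = +-mirror x≤n
  mirrorIf+mirrorIf-not true  {x} x≤n = trans (+-comm (mirror x) x) (+-mirror x≤n)

  mirrorIf-injectiveˡ : ∀ b b' x → mirrorIf b x ≡ mirrorIf b' x → b ≡ b'
  mirrorIf-injectiveˡ false false x _ = refl
  mirrorIf-injectiveˡ true  true  x _ = refl
  mirrorIf-injectiveˡ false true  x e = ⊥-elim (mirror-≢ x e)
  mirrorIf-injectiveˡ true  false x e = ⊥-elim (mirror-≢ x (sym e))

  SignOf : ℕ → ℕ → Set
  SignOf c x = x ≡ c ⊎ x ≡ mirror c

  SignOf⇒rep : ∀ {c x} → Small c → SignOf c x → InRange x × rep x ≡ c
  SignOf⇒rep c∈ (inj₁ refl) = Small⇒InRange c∈ , rep-small (proj₂ c∈)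
  SignOf⇒rep c∈ (inj₂ refl) =
    mirror-InRange (Small⇒InRange c∈) , trans (rep-mirror (Small⇒InRange c∈)) (rep-small (proj₂ c∈))

  rep⇒SignOf : ∀ {x} → InRange x → SignOf (rep x) x
  rep⇒SignOf x∈ = rep-injective x∈ (Small⇒InRange rep∈) (sym (rep-small (proj₂ rep∈)))
    where rep∈ = rep-Small x∈

  signed : ℕ → List (List ℕ) → List (List ℕ)
  signed c E = map (c ∷_) E ++ map (mirror c ∷_) E

  ∈-signed⁻ : ∀ c E {zs} → zs ∈ signed c E → ∃₂ λ x ys → zs ≡ x ∷ ys × SignOf c x × ys ∈ E
  ∈-signed⁻ c E z∈ with ∈-++⁻ (map (c ∷_) E) z∈
  ... | inj₁ z∈₁ with ys , ys∈ , refl ← ∈-map⁻ (c ∷_) z∈₁ = c , ys , refl , inj₁ refl , ys∈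
  ... | inj₂ z∈₂ with ys , ys∈ , refl ← ∈-map⁻ (mirror c ∷_) z∈₂ =
    mirror c , ys , refl , inj₂ refl , ys∈

  ∈-signed⁺ : ∀ c E {x ys} → SignOf c x → ys ∈ E → x ∷ ys ∈ signed c E
  ∈-signed⁺ c E (inj₁ refl) ys∈ = ∈-++⁺ˡ (∈-map⁺ (c ∷_) ys∈)
  ∈-signed⁺ c E (inj₂ refl) ys∈ = ∈-++⁺ʳ (map (c ∷_) E) (∈-map⁺ (mirror c ∷_) ys∈)

  length-signed : ∀ c E → length (signed c E) ≡ 2 * length E
  length-signed c E = begin
    length (map (c ∷_) E ++ map (mirror c ∷_) E)        ≡⟨ length-++ (map (c ∷_) E) ⟩
    length (map (c ∷_) E) + length (map (mirror c ∷_) E) ≡⟨ cong₂ _+_ (length-map _ E) (length-map _ E) ⟩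
    length E + length E                                  ≡⟨ cong (length E +_) (sym (+-identityʳ _)) ⟩
    2 * length E                                         ∎

  Unique-signed : ∀ c {E} → Unique E → Unique (signed c E)
  Unique-signed c uE = Unique.++⁺ (Unique.map⁺ ∷-injectiveʳ uE) (Unique.map⁺ ∷-injectiveʳ uE) disjoint
    where
    disjoint : ∀ {zs} → ¬ (zs ∈ map (c ∷_) _ × zs ∈ map (mirror c ∷_) _)
    disjoint (z∈₁ , z∈₂)
      with _ , _ , refl ← ∈-map⁻ (c ∷_) z∈₁ | _ , _ , e ← ∈-map⁻ (mirror c ∷_) z∈₂ =
      mirror-≢ c (∷-injectiveˡ e)

  IsArrangement : List ℕ → List ℕ → Set
  IsArrangement cs xs = All InRange xs × map rep xs ↭ cs

  mutual
    arrangements : ℕ → List ℕ → List (List ℕ)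
    arrangements zero    cs = [ [] ]
    arrangements (suc t) cs = concatMap (branch t) (select cs)

    branch : ℕ → ℕ × List ℕ → List (List ℕ)
    branch t (c , rest) = signed c (arrangements t rest)

  private
    length-rest : ∀ {t c} {cs rest : List ℕ} →
      length cs ≡ suc t → (c , rest) ∈ select cs → length rest ≡ t
    length-rest {cs = cs} len p = suc-injective (trans (sym (↭-length (select-↭ cs p))) len)

  length-arrangements : ∀ t cs → length cs ≡ t → length (arrangements t cs) ≡ 2 ^ t * t !
  length-arrangements zero    cs _   = refl
  length-arrangements (suc t) cs len = begin
    length (concatMap (branch t) (select cs))  ≡⟨ length-concatMap (branch t) _ (select cs) length-branch ⟩
    length (select cs) * (2 * (2 ^ t * t !))   ≡⟨ cong (_* _) (trans (length-select cs) len) ⟩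
    suc t * (2 * (2 ^ t * t !))                 ≡⟨ count t (2 ^ t) (t !) ⟩
    2 ^ suc t * suc t !                         ∎
    where
    length-branch : ∀ {p} → p ∈ select cs → length (branch t p) ≡ 2 * (2 ^ t * t !)
    length-branch {c , rest} p =
      trans (length-signed c (arrangements t rest)) (cong (2 *_) (length-arrangements t rest (length-rest len p)))
    count : ∀ t a b → suc t * (2 * (a * b)) ≡ (2 * a) * (b + t * b)
    count = solve-∀

  ∷-IsArrangement : ∀ {cs c rest x ys} → cs ↭ c ∷ rest → Small c → SignOf c x →
    IsArrangement rest ys → IsArrangement cs (x ∷ ys)
  ∷-IsArrangement cs↭ c∈ sign (ranges , perm) with x∈ , refl ← SignOf⇒rep c∈ sign =
    (x∈ ∷ ranges) , ↭-trans (↭-prep _ perm) (↭-sym cs↭)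

  arrangements-sound : ∀ t cs → All Small cs → length cs ≡ t →
    ∀ {xs} → xs ∈ arrangements t cs → IsArrangement cs xs
  arrangements-sound zero    [] _  _   (here refl) = [] , ↭-refl
  arrangements-sound (suc t) cs sm len x∈ with find (∈-concatMap⁻ (branch t) {xs = select cs} x∈)
  ... | (c , rest) , p , q with ∈-signed⁻ c (arrangements t rest) q
  ...   | x , ys , refl , sign , ys∈ =
    ∷-IsArrangement cs↭ (All.head smalls) sign
      (arrangements-sound t rest (All.tail smalls) (length-rest len p) ys∈)
    where
    cs↭ = select-↭ cs p
    smalls = All-resp-↭ cs↭ sm

  arrangements-complete : ∀ t cs → All Small cs → length cs ≡ t →
    ∀ {xs} → IsArrangement cs xs → xs ∈ arrangements t cs
  arrangements-complete zero    [] _ _ {[]}    _          = here refl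
  arrangements-complete zero    [] _ _ {_ ∷ _} (_ , perm) = ⊥-elim (¬x∷xs↭[] perm)
  arrangements-complete (suc t) cs _ len {[]} (_ , perm) with () ← trans (↭-length perm) len
  arrangements-complete (suc t) cs sm len {x ∷ ys} (x∈ ∷ ranges , perm)
    with ∈-select cs (∈-resp-↭ perm (here refl))
  ... | rest , p = ∈-concatMap⁺ (branch t) {xs = select cs}
                     (lose p (∈-signed⁺ _ (arrangements t rest) (rep⇒SignOf x∈) ys∈))
    where
    ys∈ : ys ∈ arrangements t rest
    ys∈ = arrangements-complete t rest (All.tail (All-resp-↭ (select-↭ cs p) sm)) (length-rest len p)
            (ranges , drop-∷ (↭-trans perm (select-↭ cs p)))

  arrangements-unique : ∀ t cs → Unique cs → All Small cs → length cs ≡ t → Unique (arrangements t cs)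
  arrangements-unique zero    cs _ _  _   = [] ∷ []
  arrangements-unique (suc t) cs u sm len =
    Unique-concatMap (branch t) (just ∘ proj₁) (Maybe.map rep ∘ head) (select cs)
      keys-unique unique-branch head-rep
    where
    keys-unique : Unique (map (just ∘ proj₁) (select cs))
    keys-unique = subst Unique (sym (map-∘ (select cs)))
      (Unique.map⁺ just-injective (subst Unique (sym (map-proj₁-select cs)) u))
    unique-branch : ∀ {p} → p ∈ select cs → Unique (branch t p)
    unique-branch {c , rest} p with _ ∷ urest ← Unique-resp-↭ (select-↭ cs p) u
                                  | _ ∷ srest ← All-resp-↭ (select-↭ cs p) sm =
      Unique-signed c (arrangements-unique t rest urest srest (length-rest len p))
    head-rep : ∀ {p zs} → p ∈ select cs → zs ∈ branch t p → Maybe.map rep (head zs) ≡ just (proj₁ p)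
    head-rep {c , rest} p z∈ with c∈ ∷ _ ← All-resp-↭ (select-↭ cs p) sm
                              | x , ys , refl , sign , _ ← ∈-signed⁻ c (arrangements t rest) z∈ =
      cong just (proj₂ (SignOf⇒rep c∈ sign))

  smalls : List ℕ
  smalls = applyUpTo suc N

  smalls-unique : Unique smalls
  smalls-unique = Unique.applyUpTo⁺₁ suc N (λ i<j _ e → <⇒≢ i<j (suc-injective e))

  Small⇒∈smalls : ∀ {c} → Small c → c ∈ smalls
  Small⇒∈smalls {suc c} (_ , c<N) = ∈-applyUpTo⁺ suc c<N

  ∈smalls⇒Small : ∀ {c} → c ∈ smalls → Small c
  ∈smalls⇒Small c∈ with i , i<N , refl ← ∈-applyUpTo⁻ suc c∈ = s≤s z≤n , i<N

  smalls-Small : All Small smalls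
  smalls-Small = All.tabulate ∈smalls⇒Small

  length-smalls : length smalls ≡ N
  length-smalls = length-applyUpTo suc N

  length-arrangement : ∀ {xs} → IsArrangement smalls xs → length xs ≡ N
  length-arrangement {xs} (_ , perm) = trans (sym (length-map rep xs)) (trans (↭-length perm) length-smalls)

-- Bijective labellings antipodal for an involution

nth : List ℕ → ℕ → ℕ
nth []       _       = 0
nth (x ∷ xs) zero    = x
nth (x ∷ xs) (suc j) = nth xs j

nth-∈ : ∀ xs {j} → j < length xs → nth xs j ∈ xs
nth-∈ (x ∷ xs) {zero}  _         = here refl
nth-∈ (x ∷ xs) {suc j} (s≤s j<) = there (nth-∈ xs j<)

nth-map : ∀ (g : ℕ → ℕ) xs {j} → j < length xs → nth (map g xs) j ≡ g (nth xs j)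
nth-map g (x ∷ xs) {zero}  _         = refl
nth-map g (x ∷ xs) {suc j} (s≤s j<) = nth-map g xs j<

∈⇒nth : ∀ {x} xs → x ∈ xs → ∃ λ j → j < length xs × nth xs j ≡ x
∈⇒nth (y ∷ xs) (here refl) = 0 , s≤s z≤n , refl
∈⇒nth (y ∷ xs) (there x∈) with j , j< , e ← ∈⇒nth xs x∈ = suc j , s≤s j< , e

nth-injective : ∀ {xs} → Unique xs → ∀ {i j} → i < length xs → j < length xs →
  nth xs i ≡ nth xs j → i ≡ j
nth-injective {x ∷ xs} _        {zero}  {zero}  _        _        _ = refl
nth-injective {x ∷ xs} (x∉ ∷ _) {zero}  {suc j} _        (s≤s j<) e = ⊥-elim (All.lookup x∉ (nth-∈ xs j<) e)
nth-injective {x ∷ xs} (x∉ ∷ _) {suc i} {zero}  (s≤s i<) _        e =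
  ⊥-elim (All.lookup x∉ (nth-∈ xs i<) (sym e))
nth-injective {x ∷ xs} (_ ∷ u)  {suc i} {suc j} (s≤s i<) (s≤s j<) e = cong suc (nth-injective u i< j< e)

≡-by-nth : ∀ xs ys → length xs ≡ length ys →
  (∀ {j} → j < length xs → nth xs j ≡ nth ys j) → xs ≡ ys
≡-by-nth []       []       _   _ = refl
≡-by-nth (x ∷ xs) (y ∷ ys) len h =
  cong₂ _∷_ (h (s≤s z≤n)) (≡-by-nth xs ys (suc-injective len) (h ∘ s≤s))

nth-tabulate : ∀ {t} (g : Fin t → ℕ) i → nth (tabulate g) (toℕ i) ≡ g i
nth-tabulate g Fin.zero    = refl
nth-tabulate g (Fin.suc i) = nth-tabulate (g ∘ Fin.suc) i

-- NumKDML G k N unfolds to Counted (IsKDML G k) N.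
Counted : {A : Set} → (A → Set) → ℕ → Set
Counted {A} P N = Σ (List A) λ L → Unique L × (∀ x → (x ∈ L) ⇔ P x) × length L ≡ N

Counted-resp-⇔ : ∀ {A : Set} {P Q : A → Set} {N} → (∀ x → P x ⇔ Q x) → Counted P N → Counted Q N
Counted-resp-⇔ P⇔Q (L , u , ∈⇔P , len) = L , u , (λ x → ⇔-trans (∈⇔P x) (P⇔Q x)) , len

-- IsBijLabeling G unfolds to IsBijection (order G).
IsBijection : (n : ℕ) → Vec ℕ n → Set
IsBijection n f =
  (∀ v → 1 ≤ lookup f v × lookup f v ≤ n)
  × (∀ u v → lookup f u ≡ lookup f v → u ≡ v)
  × (∀ j → 1 ≤ j → j ≤ n → ∃ λ v → lookup f v ≡ j)

IsAntipodal : ∀ {n} → (Fin n → Fin n) → Vec ℕ n → Set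
IsAntipodal σ f = ∃ λ c → ∀ v → lookup f v + lookup f (σ v) ≡ c

-- Identifies the vertex set with Fin N × Bool so that σ only flips the Boolean.
record OrbitCoordinates {n : ℕ} (σ : Fin n → Fin n) (N : ℕ) : Set where
  field
    orbit        : Fin n → Fin N
    side         : Fin n → Bool
    point        : Bool → Fin N → Fin n
    orbit-point  : ∀ b j → orbit (point b j) ≡ j
    side-point   : ∀ b j → side (point b j) ≡ b
    point-coords : ∀ v → point (side v) (orbit v) ≡ v
    orbit-σ      : ∀ v → orbit (σ v) ≡ orbit v
    side-σ       : ∀ v → side (σ v) ≡ not (side v)

  coords-injective : ∀ {u v} → orbit u ≡ orbit v → side u ≡ side v → u ≡ v
  coords-injective {u} {v} o s = trans (sym (point-coords u)) (trans (cong₂ point s o) (point-coords v))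

  σ-point : ∀ b j → σ (point b j) ≡ point (not b) j
  σ-point b j = coords-injective
    (trans (orbit-σ _) (trans (orbit-point b j) (sym (orbit-point (not b) j))))
    (trans (side-σ _) (trans (cong not (side-point b j)) (sym (side-point (not b) j))))

module AntipodalLabellings (N : ℕ) (1≤N : 1 ≤ N) {σ : Fin (N + N) → Fin (N + N)}
                           (coords : OrbitCoordinates σ N) where

  open SignedArrangements N
  open OrbitCoordinates coords
  open ≡-Reasoning

  labelling : List ℕ → Vec ℕ n
  labelling xs = tabulateᵛ (λ v → mirrorIf (side v) (nth xs (toℕ (orbit v))))

  lookup-labelling : ∀ xs v → lookup (labelling xs) v ≡ mirrorIf (side v) (nth xs (toℕ (orbit v)))
  lookup-labelling xs v = lookup∘tabulate _ v

  lookup-labelling-point : ∀ xs b j → lookup (labelling xs) (point b j) ≡ mirrorIf b (nth xs (toℕ j))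
  lookup-labelling-point xs b j = trans (lookup-labelling xs (point b j))
    (cong₂ (λ s i → mirrorIf s (nth xs (toℕ i))) (side-point b j) (orbit-point b j))

  labellings : List (Vec ℕ n)
  labellings = map labelling (arrangements N smalls)

  module FromArrangement (xs : List ℕ) (arr : IsArrangement smalls xs) where

    private
      f = labelling xs

      index< : ∀ j → toℕ j < length xs
      index< j = subst (toℕ j <_) (sym (length-arrangement arr)) (toℕ<n j)
      index<map : ∀ j → toℕ j < length (map rep xs)
      index<map j = subst (toℕ j <_) (sym (length-map rep xs)) (index< j)

    entry-InRange : ∀ j → InRange (nth xs (toℕ j))
    entry-InRange j = All.lookup (proj₁ arr) (nth-∈ xs (index< j))

    rep-entry : ∀ j → nth (map rep xs) (toℕ j) ≡ rep (nth xs (toℕ j))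
    rep-entry j = nth-map rep xs (index< j)

    rep-entry-injective : ∀ i j → rep (nth xs (toℕ i)) ≡ rep (nth xs (toℕ j)) → i ≡ j
    rep-entry-injective i j e = toℕ-injective
      (nth-injective (Unique-resp-↭ (↭-sym (proj₂ arr)) smalls-unique)
        (index<map i) (index<map j)
        (trans (rep-entry i) (trans e (sym (rep-entry j)))))

    rep-entry-surjective : ∀ {c} → Small c → ∃ λ j → rep (nth xs (toℕ j)) ≡ c
    rep-entry-surjective c∈
      with i , i< , e ← ∈⇒nth (map rep xs) (∈-resp-↭ (↭-sym (proj₂ arr)) (Small⇒∈smalls c∈)) =
      j , trans (sym (rep-entry j)) (trans (cong (nth (map rep xs)) (toℕ-fromℕ< i<N)) e)
      where
      i<N = subst (i <_) (trans (length-map rep xs) (length-arrangement arr)) i<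
      j = fromℕ< i<N

    label-InRange : ∀ v → InRange (lookup f v)
    label-InRange v =
      subst InRange (sym (lookup-labelling xs v)) (mirrorIf-InRange (side v) (entry-InRange (orbit v)))

    rep-label : ∀ v → rep (lookup f v) ≡ rep (nth xs (toℕ (orbit v)))
    rep-label v = trans (cong rep (lookup-labelling xs v)) (rep-mirrorIf (side v) (entry-InRange (orbit v)))

    label-injective : ∀ u v → lookup f u ≡ lookup f v → u ≡ v
    label-injective u v e = coords-injective same-orbit same-side
      where
      same-orbit : orbit u ≡ orbit v
      same-orbit = rep-entry-injective (orbit u) (orbit v)
        (trans (sym (rep-label u)) (trans (cong rep e) (rep-label v)))
      entry = nth xs (toℕ (orbit u))
      same-side : side u ≡ side v
      same-side = mirrorIf-injectiveˡ (side u) (side v) entry (begin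
        mirrorIf (side u) entry               ≡⟨ lookup-labelling xs u ⟨
        lookup f u                            ≡⟨ e ⟩
        lookup f v                            ≡⟨ lookup-labelling xs v ⟩
        mirrorIf (side v) (nth xs (toℕ (orbit v)))
          ≡⟨ cong (λ o → mirrorIf (side v) (nth xs (toℕ o))) same-orbit ⟨
        mirrorIf (side v) entry               ∎)

    label-surjective : ∀ x → 1 ≤ x → x ≤ n → ∃ λ v → lookup f v ≡ x
    label-surjective x 1≤x x≤n with j , e ← rep-entry-surjective (rep-Small (1≤x , x≤n))
      with rep-injective (entry-InRange j) (1≤x , x≤n) e
    ... | inj₁ e′ = point false j , trans (lookup-labelling-point xs false j) e′
    ... | inj₂ e′ = point true j ,
      trans (lookup-labelling-point xs true j) (trans (cong mirror e′) (mirror-involutive x≤n))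

    label-antipodal : ∀ v → lookup f v + lookup f (σ v) ≡ suc n
    label-antipodal v = begin
      lookup f v + lookup f (σ v)
        ≡⟨ cong₂ _+_ (lookup-labelling xs v) (lookup-labelling xs (σ v)) ⟩
      mirrorIf (side v) entry + mirrorIf (side (σ v)) (nth xs (toℕ (orbit (σ v))))
        ≡⟨ cong₂ (λ s o → mirrorIf (side v) entry + mirrorIf s (nth xs (toℕ o))) (side-σ v) (orbit-σ v) ⟩
      mirrorIf (side v) entry + mirrorIf (not (side v)) entry
        ≡⟨ mirrorIf+mirrorIf-not (side v) (proj₂ (entry-InRange (orbit v))) ⟩
      suc n ∎
      where entry = nth xs (toℕ (orbit v))

    labelling-antipodal-bijection : IsBijection n f × IsAntipodal σ f
    labelling-antipodal-bijection =
      (label-InRange , label-injective , label-surjective) , suc n , label-antipodal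

  module FromLabelling (f : Vec ℕ n) (bij : IsBijection n f) (anti : IsAntipodal σ f) where

    private
      F = lookup f
      label-InRange = proj₁ bij
      label-injective = proj₁ (proj₂ bij)
      label-surjective = proj₂ (proj₂ bij)
      c = proj₁ anti
      1≤n : 1 ≤ n
      1≤n = ≤-trans 1≤N N≤n

    -- Compare the sums at the vertices labelled 1 and n.
    antipodal-sum : c ≡ suc n
    antipodal-sum
      with v₁ , F≡1 ← label-surjective 1 ≤-refl 1≤n | vₙ , F≡n ← label-surjective n 1≤n ≤-refl =
      ≤-antisym
        (subst (_≤ suc n) (trans (cong (_+ F (σ v₁)) (sym F≡1)) (proj₂ anti v₁))
          (s≤s (proj₂ (label-InRange (σ v₁)))))
        (subst (suc n ≤_) (trans (cong (_+ F (σ vₙ)) (sym F≡n)) (proj₂ anti vₙ))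
          (≤-trans (≤-reflexive (+-comm 1 n)) (+-monoʳ-≤ n (proj₁ (label-InRange (σ vₙ))))))

    label-σ : ∀ v → F (σ v) ≡ mirror (F v)
    label-σ v = trans (sym (m+n∸m≡n (F v) (F (σ v)))) (cong (_∸ F v) (trans (proj₂ anti v) antipodal-sum))

    label-point : ∀ b j → F (point b j) ≡ mirrorIf b (F (point false j))
    label-point false _ = refl
    label-point true  j = trans (cong F (sym (σ-point false j))) (label-σ _)

    arrangementOf : List ℕ
    arrangementOf = tabulate (F ∘ point false)

    label-via-arrangementOf : ∀ v → mirrorIf (side v) (nth arrangementOf (toℕ (orbit v))) ≡ F v
    label-via-arrangementOf v = begin
      mirrorIf (side v) (nth arrangementOf (toℕ (orbit v)))
        ≡⟨ cong (mirrorIf (side v)) (nth-tabulate _ (orbit v)) ⟩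
      mirrorIf (side v) (F (point false (orbit v)))        ≡⟨ label-point (side v) (orbit v) ⟨
      F (point (side v) (orbit v))                          ≡⟨ cong F (point-coords v) ⟩
      F v                                                   ∎

    labelling-arrangementOf : labelling arrangementOf ≡ f
    labelling-arrangementOf = trans (tabulateᵛ-cong label-via-arrangementOf) (tabulate∘lookup f)

    rep-point-injective : ∀ i j → rep (F (point false i)) ≡ rep (F (point false j)) → i ≡ j
    rep-point-injective i j e with rep-injective (label-InRange _) (label-InRange _) e
    ... | inj₁ e′ = begin
      i                       ≡⟨ orbit-point false i ⟨
      orbit (point false i)   ≡⟨ cong orbit (label-injective _ _ e′) ⟩
      orbit (point false j)   ≡⟨ orbit-point false j ⟩
      j                       ∎
    ... | inj₂ e′ with () ← begin
      false                   ≡⟨ side-point false i ⟨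
      side (point false i)    ≡⟨ cong side (label-injective _ _ (trans e′ (sym (label-point true j)))) ⟩
      side (point true j)     ≡⟨ side-point true j ⟩
      true                    ∎

    arrangementOf-IsArrangement : IsArrangement smalls arrangementOf
    arrangementOf-IsArrangement =
      All.tabulate entry-InRange , Unique⇒↭ reps-unique smalls-unique reps⊆smalls smalls⊆reps
      where
      entry-InRange : ∀ {x} → x ∈ arrangementOf → InRange x
      entry-InRange x∈ with i , refl ← ∈-tabulate⁻ x∈ = label-InRange _
      reps-unique : Unique (map rep arrangementOf)
      reps-unique = subst Unique (sym (map-tabulate _ rep)) (Unique.tabulate⁺ (rep-point-injective _ _))
      reps⊆smalls : ∀ {x} → x ∈ map rep arrangementOf → x ∈ smalls
      reps⊆smalls x∈ with y , y∈ , refl ← ∈-map⁻ rep x∈ =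
        Small⇒∈smalls (rep-Small (entry-InRange y∈))
      smalls⊆reps : ∀ {x} → x ∈ smalls → x ∈ map rep arrangementOf
      smalls⊆reps {x} x∈ with c∈ ← ∈smalls⇒Small x∈
        with v , F≡x ← label-surjective x (proj₁ c∈) (≤-trans (proj₂ c∈) N≤n) =
        subst (_∈ map rep arrangementOf) rep≡x (∈-map⁺ rep (∈-tabulate⁺ (orbit v)))
        where
        rep≡x : rep (F (point false (orbit v))) ≡ x
        rep≡x = begin
          rep (F (point false (orbit v)))                     ≡⟨ rep-mirrorIf (side v) (label-InRange _) ⟨
          rep (mirrorIf (side v) (F (point false (orbit v)))) ≡⟨ cong rep (label-point (side v) (orbit v)) ⟨
          rep (F (point (side v) (orbit v)))                  ≡⟨ cong (rep ∘ F) (point-coords v) ⟩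
          rep (F v)                                           ≡⟨ cong rep F≡x ⟩
          rep x                                               ≡⟨ rep-small (proj₂ c∈) ⟩
          x                                                   ∎

  labelling-injective : ∀ {xs ys} → IsArrangement smalls xs → IsArrangement smalls ys →
    labelling xs ≡ labelling ys → xs ≡ ys
  labelling-injective {xs} {ys} arr-xs arr-ys e =
    ≡-by-nth xs ys (trans (length-arrangement arr-xs) (sym (length-arrangement arr-ys))) entries
    where
    entries : ∀ {i} → i < length xs → nth xs i ≡ nth ys i
    entries {i} i< = begin
      nth xs i                               ≡⟨ cong (nth xs) (toℕ-fromℕ< i<N) ⟨
      nth xs (toℕ j)                         ≡⟨ lookup-labelling-point xs false j ⟨
      lookup (labelling xs) (point false j)  ≡⟨ cong (λ g → lookup g (point false j)) e ⟩
      lookup (labelling ys) (point false j)  ≡⟨ lookup-labelling-point ys false j ⟩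
      nth ys (toℕ j)                         ≡⟨ cong (nth ys) (toℕ-fromℕ< i<N) ⟩
      nth ys i                               ∎
      where
      i<N = subst (i <_) (length-arrangement arr-xs) i<
      j = fromℕ< i<N

  labellings-counted : Counted (λ f → IsBijection n f × IsAntipodal σ f) (2 ^ N * N !)
  labellings-counted = labellings , labellings-unique , ∈labellings⇔ , labellings-length
    where
    sound : ∀ {xs} → xs ∈ arrangements N smalls → IsArrangement smalls xs
    sound = arrangements-sound N smalls smalls-Small length-smalls
    labellings-unique : Unique labellings
    labellings-unique = Unique-map-on labelling (arrangements N smalls)
      (λ x∈ y∈ → labelling-injective (sound x∈) (sound y∈))
      (arrangements-unique N smalls smalls-unique smalls-Small length-smalls)
    ∈labellings⇔ : ∀ f → (f ∈ labellings) ⇔ (IsBijection n f × IsAntipodal σ f)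
    ∈labellings⇔ f = mk⇔ to from
      where
      to : f ∈ labellings → IsBijection n f × IsAntipodal σ f
      to f∈ with xs , xs∈ , refl ← ∈-map⁻ labelling f∈ =
        FromArrangement.labelling-antipodal-bijection xs (sound xs∈)
      from : IsBijection n f × IsAntipodal σ f → f ∈ labellings
      from (bij , anti) = subst (_∈ labellings) labelling-arrangementOf
        (∈-map⁺ labelling (arrangements-complete N smalls smalls-Small length-smalls arrangementOf-IsArrangement))
        where open FromLabelling f bij anti
    labellings-length : length labellings ≡ 2 ^ N * N !
    labellings-length = trans (length-map labelling (arrangements N smalls))
                              (length-arrangements N smalls length-smalls)

antipodalBijections-counted : ∀ {n} N → n ≡ N + N → 1 ≤ N →
  {σ : Fin n → Fin n} → OrbitCoordinates σ N →
  Counted (λ f → IsBijection n f × IsAntipodal σ f) (2 ^ N * N !)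
antipodalBijections-counted N refl 1≤N coords = AntipodalLabellings.labellings-counted N 1≤N coords

-- Spheres in a disjoint union of cycles C₄ₖ

¬T⇒≡false : ∀ {b} → ¬ T b → b ≡ false
¬T⇒≡false {false} _  = refl
¬T⇒≡false {true}  ¬t = ⊥-elim (¬t tt)

sum-tabulate-0 : ∀ {n} (h : Fin n → ℕ) → (∀ w → h w ≡ 0) → sum (tabulate h) ≡ 0
sum-tabulate-0 {zero}  h _ = refl
sum-tabulate-0 {suc n} h z = cong₂ _+_ (z Fin.zero) (sum-tabulate-0 (h ∘ Fin.suc) (z ∘ Fin.suc))

sum-tabulate-single : ∀ {n} (h : Fin n → ℕ) a → (∀ w → w ≢ a → h w ≡ 0) → sum (tabulate h) ≡ h a
sum-tabulate-single {suc n} h Fin.zero z =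
  trans (cong (h Fin.zero +_) (sum-tabulate-0 (h ∘ Fin.suc) (λ w → z (Fin.suc w) λ ()))) (+-identityʳ _)
sum-tabulate-single {suc n} h (Fin.suc a) z =
  cong₂ _+_ (z Fin.zero λ ())
    (sum-tabulate-single (h ∘ Fin.suc) a (λ w w≢a → z (Fin.suc w) (w≢a ∘ Finₚ.suc-injective)))

sum-tabulate-pair : ∀ {n} (h : Fin n → ℕ) {a b} → a ≢ b → (∀ w → w ≢ a → w ≢ b → h w ≡ 0) →
  sum (tabulate h) ≡ h a + h b
sum-tabulate-pair {suc n} h {Fin.zero} {Fin.zero} a≢b _ = ⊥-elim (a≢b refl)
sum-tabulate-pair {suc n} h {Fin.zero} {Fin.suc b} _ z =
  cong (h Fin.zero +_)
    (sum-tabulate-single (h ∘ Fin.suc) b (λ w w≢b → z (Fin.suc w) (λ ()) (w≢b ∘ Finₚ.suc-injective)))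
sum-tabulate-pair {suc n} h {Fin.suc a} {Fin.zero} _ z =
  trans (cong (h Fin.zero +_)
           (sum-tabulate-single (h ∘ Fin.suc) a (λ w w≢a → z (Fin.suc w) (w≢a ∘ Finₚ.suc-injective) (λ ()))))
        (+-comm (h Fin.zero) _)
sum-tabulate-pair {suc n} h {Fin.suc a} {Fin.suc b} a≢b z =
  cong₂ _+_ (z Fin.zero (λ ()) (λ ()))
    (sum-tabulate-pair (h ∘ Fin.suc) (a≢b ∘ cong Fin.suc)
      (λ w w≢a w≢b → z (Fin.suc w) (w≢a ∘ Finₚ.suc-injective) (w≢b ∘ Finₚ.suc-injective)))

module ModularArithmetic (p : ℕ) .{{_ : NonZero p}} where

  open ≡-Reasoning

  [m%p+n]%p≡[m+n]%p : ∀ a b → (a % p + b) % p ≡ (a + b) % p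
  [m%p+n]%p≡[m+n]%p a b = begin
    (a % p + b) % p          ≡⟨ %-distribˡ-+ (a % p) b p ⟩
    (a % p % p + b % p) % p  ≡⟨ cong (λ z → (z + b % p) % p) (m%n%n≡m%n a p) ⟩
    (a % p + b % p) % p      ≡⟨ %-distribˡ-+ a b p ⟨
    (a + b) % p              ∎

  +-cancelʳ-% : ∀ a b c → (a + c) % p ≡ (b + c) % p → a % p ≡ b % p
  +-cancelʳ-% a b c e = trans (sym (undo a)) (trans (cong (λ z → (z + c′) % p) e) (undo b))
    where
    -- c + c′ is a multiple of p
    c′ = c * p ∸ c
    undo : ∀ z → ((z + c) % p + c′) % p ≡ z % p
    undo z = begin
      ((z + c) % p + c′) % p  ≡⟨ [m%p+n]%p≡[m+n]%p (z + c) c′ ⟩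
      (z + c + c′) % p        ≡⟨ cong (_% p) (+-assoc z c c′) ⟩
      (z + (c + c′)) % p      ≡⟨ cong (λ w → (z + w) % p) (m+[n∸m]≡n (m≤m*n c p)) ⟩
      (z + c * p) % p         ≡⟨ [m+kn]%n≡m%n z c p ⟩
      z % p                   ∎

  +-cancelˡ-% : ∀ c a b → (c + a) % p ≡ (c + b) % p → a % p ≡ b % p
  +-cancelˡ-% c a b e =
    +-cancelʳ-% a b c (trans (cong (_% p) (+-comm a c)) (trans e (cong (_% p) (+-comm c b))))

module CycleUnion (m′ k′ : ℕ) where

  m k p : ℕ
  m = suc m′
  k = suc k′
  p = 4 * k

  G : Graph
  G = unionCycles m p

  V : Set
  V = Fin (m * p)

  open ModularArithmetic p
  open ≡-Reasoning

  copy : V → Fin m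
  copy x = proj₁ (remQuot {m} p x)

  pos : V → ℕ
  pos x = toℕ (proj₂ (remQuot {m} p x))

  vertex : Fin m → ℕ → V
  vertex i a = combine i (fromℕ< (m%n<n a p))

  copy-vertex : ∀ i a → copy (vertex i a) ≡ i
  copy-vertex i a = cong proj₁ (remQuot-combine i (fromℕ< (m%n<n a p)))

  pos-vertex : ∀ i a → pos (vertex i a) ≡ a % p
  pos-vertex i a = trans (cong (toℕ ∘ proj₂) (remQuot-combine i (fromℕ< (m%n<n a p)))) (toℕ-fromℕ< _)

  ≡-by-coords : ∀ {x y} → copy x ≡ copy y → pos x ≡ pos y → x ≡ y
  ≡-by-coords {x} {y} c p′ = begin
    x                                           ≡⟨ combine-remQuot {m} p x ⟨
    combine (copy x) (proj₂ (remQuot {m} p x))  ≡⟨ cong₂ combine c (toℕ-injective p′) ⟩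
    combine (copy y) (proj₂ (remQuot {m} p y))  ≡⟨ combine-remQuot {m} p y ⟩
    y                                           ∎

  pos<p : ∀ x → pos x < p
  pos<p x = toℕ<n _

  pos%p : ∀ x → pos x % p ≡ pos x
  pos%p x = m<n⇒m%n≡m (pos<p x)

  shift : V → ℕ → V
  shift x d = vertex (copy x) (pos x + d)

  copy-shift : ∀ x d → copy (shift x d) ≡ copy x
  copy-shift x d = copy-vertex (copy x) (pos x + d)

  pos-shift : ∀ x d → pos (shift x d) ≡ (pos x + d) % p
  pos-shift x d = pos-vertex (copy x) (pos x + d)

  shift-0 : ∀ x → shift x 0 ≡ x
  shift-0 x = ≡-by-coords (copy-shift x 0)
    (trans (pos-shift x 0) (trans (cong (_% p) (+-identityʳ (pos x))) (pos%p x)))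

  shift-+ : ∀ x d e → shift (shift x d) e ≡ shift x (d + e)
  shift-+ x d e = ≡-by-coords
    (trans (copy-shift (shift x d) e) (trans (copy-shift x d) (sym (copy-shift x (d + e))))) (begin
    pos (shift (shift x d) e)   ≡⟨ pos-shift (shift x d) e ⟩
    (pos (shift x d) + e) % p   ≡⟨ cong (λ z → (z + e) % p) (pos-shift x d) ⟩
    ((pos x + d) % p + e) % p   ≡⟨ [m%p+n]%p≡[m+n]%p (pos x + d) e ⟩
    (pos x + d + e) % p         ≡⟨ cong (_% p) (+-assoc (pos x) d e) ⟩
    (pos x + (d + e)) % p       ≡⟨ pos-shift x (d + e) ⟨
    pos (shift x (d + e))       ∎)

  shift-+p : ∀ x d → shift x (d + p) ≡ shift x d
  shift-+p x d = ≡-by-coords (trans (copy-shift x (d + p)) (sym (copy-shift x d))) (begin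
    pos (shift x (d + p))   ≡⟨ pos-shift x (d + p) ⟩
    (pos x + (d + p)) % p   ≡⟨ cong (_% p) (+-assoc (pos x) d p) ⟨
    (pos x + d + p) % p     ≡⟨ [m+n]%n≡m%n (pos x + d) p ⟩
    (pos x + d) % p         ≡⟨ pos-shift x d ⟨
    pos (shift x d)         ∎)

  shift-p : ∀ x → shift x p ≡ x
  shift-p x = trans (shift-+p x 0) (shift-0 x)

  shift-injectiveˡ : ∀ {x y} d → shift x d ≡ shift y d → x ≡ y
  shift-injectiveˡ {x} {y} d e = ≡-by-coords
    (trans (sym (copy-shift x d)) (trans (cong copy e) (copy-shift y d)))
    (trans (sym (pos%p x)) (trans (+-cancelʳ-% (pos x) (pos y) d
      (trans (sym (pos-shift x d)) (trans (cong pos e) (pos-shift y d)))) (pos%p y)))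

  shift-injectiveʳ : ∀ x {d e} → d < p → e < p → shift x d ≡ shift x e → d ≡ e
  shift-injectiveʳ x {d} {e} d<p e<p eq = begin
    d      ≡⟨ m<n⇒m%n≡m d<p ⟨
    d % p  ≡⟨ +-cancelˡ-% (pos x) d e (trans (sym (pos-shift x d)) (trans (cong pos eq) (pos-shift x e))) ⟩
    e % p  ≡⟨ m<n⇒m%n≡m e<p ⟩
    e      ∎

  Apart : ℕ → V → V → Set
  Apart d x y = y ≡ shift x d ⊎ x ≡ shift y d

  Apart-sym : ∀ {d x y} → Apart d x y → Apart d y x
  Apart-sym (inj₁ e) = inj₂ e
  Apart-sym (inj₂ e) = inj₁ e

  succMod-< : ∀ {i} → i < p → succMod p i ≡ suc i % p
  succMod-< {i} i<p with suc i ≡ᵇ p in eq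
  ... | true  = trans (sym (n%n≡0 p)) (cong (_% p) (sym (≡ᵇ⇒≡ (suc i) p (subst T (sym eq) tt))))
  ... | false = sym (m<n⇒m%n≡m (≤∧≢⇒< i<p (λ e → subst T eq (≡⇒≡ᵇ (suc i) p e))))

  succMod-pos : ∀ x → succMod p (pos x) ≡ pos (shift x 1)
  succMod-pos x = trans (succMod-< (pos<p x)) (trans (cong (_% p) (+-comm 1 (pos x))) (sym (pos-shift x 1)))

  T-adj⇔ : ∀ x y →
    T (adj G x y) ⇔ (copy x ≡ copy y × (succMod p (pos x) ≡ pos y ⊎ succMod p (pos y) ≡ pos x))
  T-adj⇔ x y = mk⇔
    (λ t → let same , t′ = Equivalence.to T-∧ t in
      toWitness same , Sum.map (≡ᵇ⇒≡ _ _) (≡ᵇ⇒≡ _ _) (Equivalence.to T-∨ t′))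
    (λ (same , s) → Equivalence.from T-∧
      (fromWitness same , Equivalence.from T-∨ (Sum.map (≡⇒≡ᵇ _ _) (≡⇒≡ᵇ _ _) s)))

  adj⇒Apart : ∀ {x y} → T (adj G x y) → Apart 1 x y
  adj⇒Apart {x} {y} t with Equivalence.to (T-adj⇔ x y) t
  ... | same , inj₁ fwd =
    inj₁ (≡-by-coords (trans (sym same) (sym (copy-shift x 1))) (trans (sym fwd) (succMod-pos x)))
  ... | same , inj₂ bwd =
    inj₂ (≡-by-coords (trans same (sym (copy-shift y 1))) (trans (sym bwd) (succMod-pos y)))

  Apart⇒adj : ∀ {x y} → Apart 1 x y → T (adj G x y)
  Apart⇒adj {x} (inj₁ refl) =
    Equivalence.from (T-adj⇔ x (shift x 1)) (sym (copy-shift x 1) , inj₁ (succMod-pos x))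
  Apart⇒adj {y = y} (inj₂ refl) =
    Equivalence.from (T-adj⇔ (shift y 1) y) (copy-shift y 1 , inj₂ (succMod-pos y))

  shift-suc : ∀ x d → shift x (suc d) ≡ shift (shift x d) 1
  shift-suc x d = sym (trans (shift-+ x d 1) (cong (shift x) (+-comm d 1)))

  Apart-step : ∀ {u v w} e → Apart 1 u v → Apart e v w → ∃ λ e′ → e′ ≤ suc e × Apart e′ u w
  Apart-step {u} e (inj₁ refl) (inj₁ refl) = suc e , ≤-refl , inj₁ (shift-+ u 1 e)
  Apart-step {w = w} e (inj₂ refl) (inj₂ refl) = suc e , ≤-refl , inj₂ (sym (shift-suc w e))
  Apart-step {w = w} zero (inj₁ v≡) (inj₂ v≡′) =
    1 , ≤-refl , inj₁ (trans (sym (shift-0 w)) (trans (sym v≡′) v≡))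
  Apart-step {w = w} (suc e) (inj₁ v≡) (inj₂ v≡′) =
    e , m≤n⇒m≤1+n (n≤1+n e) , inj₂ (shift-injectiveˡ 1 (trans (sym v≡) (trans v≡′ (shift-suc w e))))
  Apart-step {v = v} zero (inj₂ u≡) (inj₁ w≡) =
    1 , ≤-refl , inj₂ (trans u≡ (cong (λ z → shift z 1) (trans (sym (shift-0 v)) (sym w≡))))
  Apart-step {u} {v} (suc e) (inj₂ u≡) (inj₁ w≡) =
    e , m≤n⇒m≤1+n (n≤1+n e) ,
    inj₁ (trans w≡ (trans (sym (shift-+ v 1 e)) (cong (λ z → shift z e) (sym u≡))))

  walk⇒Apart : ∀ j u w → T (walk G j u w) → ∃ λ e → e ≤ j × Apart e u w
  walk⇒Apart zero    u w t = 0 , z≤n , inj₁ (trans (sym (toWitness t)) (sym (shift-0 u)))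
  walk⇒Apart (suc j) u w t
    with w′ , _ , t′ ← find (any⁻ _ (allFin (m * p)) t)
    with step , rest ← Equivalence.to T-∧ t′
    with e , e≤j , apart ← walk⇒Apart j w′ w rest
    with e′ , e′≤ , apart′ ← Apart-step e (adj⇒Apart step) apart =
    e′ , ≤-trans e′≤ (s≤s e≤j) , apart′

  walk-step : ∀ {j u v w} → Apart 1 u v → T (walk G j v w) → T (walk G (suc j) u w)
  walk-step {j} {u} {v} {w} a t = any⁺ (λ v′ → adj G u v′ ∧ walk G j v′ w)
    (lose (∈-allFin v) (Equivalence.from (T-∧ {adj G u v}) (Apart⇒adj a , t)))

  walk-shift : ∀ d u → T (walk G d u (shift u d))
  walk-shift zero    u = fromWitness (sym (shift-0 u))
  walk-shift (suc d) u = walk-step {d} {u} {shift u 1} (inj₁ refl)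
    (subst (T ∘ walk G d (shift u 1)) (shift-+ u 1 d) (walk-shift d (shift u 1)))

  walk-unshift : ∀ d w → T (walk G d (shift w d) w)
  walk-unshift zero    w = fromWitness (shift-0 w)
  walk-unshift (suc d) w = walk-step {d} {shift w (suc d)} {shift w d} {w} (inj₂ (shift-suc w d)) (walk-unshift d w)

  Apart⇒walk : ∀ d {u w} → Apart d u w → T (walk G d u w)
  Apart⇒walk d {u}     (inj₁ refl) = walk-shift d u
  Apart⇒walk d {w = w} (inj₂ refl) = walk-unshift d w

  k<p : k < p
  k<p = m<m+n k {3 * k} (s≤s z≤n)

  private
    far : ∀ {e x y} → e < k → y ≡ shift x k → ¬ Apart e x y
    far {e} {x} e<k refl (inj₁ y≡) = <⇒≢ e<k (sym (shift-injectiveʳ x k<p (<-trans e<k k<p) y≡))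
    far {e} {x} e<k refl (inj₂ x≡)
      with () ← shift-injectiveʳ x {0} {k + e} (s≤s z≤n) (+-monoʳ-< k (<-≤-trans e<k (m≤m+n k (2 * k))))
                  (trans (shift-0 x) (trans x≡ (shift-+ x k e)))

  Apart-below : ∀ {e x y} → e < k → Apart k x y → ¬ Apart e x y
  Apart-below e<k (inj₁ y≡) = far e<k y≡
  Apart-below e<k (inj₂ x≡) = far e<k x≡ ∘ Apart-sym

  distIs-k⇔Apart : ∀ u w → T (distIs G u w k) ⇔ Apart k u w
  distIs-k⇔Apart u w = mk⇔ to from
    where
    shorter = any (λ j → walk G j u w) (upTo k)
    to : T (distIs G u w k) → Apart k u w
    to t with walked , unshort ← Equivalence.to (T-∧ {walk G k u w}) t
         with e , e≤k , apart ← walk⇒Apart k u w walked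
         with m≤n⇒m<n∨m≡n e≤k
    ... | inj₂ refl = apart
    ... | inj₁ e<k  with () ← subst T (Equivalence.to T-not-≡ unshort)
                                (any⁺ _ (lose (∈-upTo⁺ e<k) (Apart⇒walk e apart)))
    from : Apart k u w → T (distIs G u w k)
    from apart = Equivalence.from (T-∧ {walk G k u w})
      (Apart⇒walk k apart , Equivalence.from T-not-≡ (¬T⇒≡false no-shorter))
      where
      no-shorter : ¬ T shorter
      no-shorter t with j , j∈ , tj ← find (any⁻ _ (upTo k) t)
                   with e , e≤j , apart′ ← walk⇒Apart j u w tj =
        Apart-below (≤-<-trans e≤j (∈-upTo⁻ j∈)) apart apart′

  shift-3k-k : ∀ x → shift (shift x (3 * k)) k ≡ x
  shift-3k-k x = trans (shift-+ x (3 * k) k) (trans (cong (shift x) (+-comm (3 * k) k)) (shift-p x))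

  Apart-k⇔ : ∀ {u w} → Apart k u w ⇔ (w ≡ shift u k ⊎ w ≡ shift u (3 * k))
  Apart-k⇔ {u} {w} = mk⇔ (Sum.map₂ back) (Sum.map₂ forth)
    where
    back : u ≡ shift w k → w ≡ shift u (3 * k)
    back refl = sym (trans (shift-+ w k (3 * k)) (shift-p w))
    forth : w ≡ shift u (3 * k) → u ≡ shift w k
    forth refl = sym (shift-3k-k u)

  sphereSum-k : ∀ f u → sphereSum G k f u ≡ lookup f (shift u k) + lookup f (shift u (3 * k))
  sphereSum-k f u = begin
    sum (map h (allFin (m * p)))                        ≡⟨ cong sum (map-tabulate id h) ⟩
    sum (tabulate h)                                    ≡⟨ sum-tabulate-pair h k≢3k outside ⟩
    h (shift u k) + h (shift u (3 * k))                 ≡⟨ cong₂ _+_ (inside (inj₁ refl)) (inside (inj₂ refl)) ⟩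
    lookup f (shift u k) + lookup f (shift u (3 * k))   ∎
    where
    h : V → ℕ
    h w = if distIs G u w k then lookup f w else 0
    inside : ∀ {w} → (w ≡ shift u k ⊎ w ≡ shift u (3 * k)) → h w ≡ lookup f w
    inside {w} w∈ =
      if-cong (Equivalence.to T-≡ (Equivalence.from (distIs-k⇔Apart u w) (Equivalence.from Apart-k⇔ w∈)))
    outside : ∀ w → w ≢ shift u k → w ≢ shift u (3 * k) → h w ≡ 0
    outside w w≢k w≢3k = if-cong (¬T⇒≡false λ t →
      Sum.[ w≢k , w≢3k ] (Equivalence.to Apart-k⇔ (Equivalence.to (distIs-k⇔Apart u w) t)))
    k≢3k : shift u k ≢ shift u (3 * k)
    k≢3k e = <⇒≢ (m<m+n k {2 * k} (s≤s z≤n)) (shift-injectiveʳ u k<p (m<n+m (3 * k) {k} (s≤s z≤n)) e)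

  σ : V → V
  σ v = shift v (2 * k)

  shift-3k-3k : ∀ x → shift (shift x (3 * k)) (3 * k) ≡ σ x
  shift-3k-3k x = trans (shift-+ x (3 * k) (3 * k)) (trans (cong (shift x) (six k)) (shift-+p x (2 * k)))
    where
    six : ∀ k → 3 * k + 3 * k ≡ 2 * k + 4 * k
    six = solve-∀

  antipodal⇔IsKDML : ∀ f → (IsBijection (m * p) f × IsAntipodal σ f) ⇔ IsKDML G k f
  antipodal⇔IsKDML f = mk⇔ from to
    where
    to : IsKDML G k f → IsBijection (m * p) f × IsAntipodal σ f
    to (bij , c , sums) = bij , c , λ v → begin
      lookup f v + lookup f (σ v)
        ≡⟨ cong₂ (λ x y → lookup f x + lookup f y) (shift-3k-k v) (shift-3k-3k v) ⟨
      lookup f (shift (shift v (3 * k)) k) + lookup f (shift (shift v (3 * k)) (3 * k))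
        ≡⟨ sphereSum-k f (shift v (3 * k)) ⟨
      sphereSum G k f (shift v (3 * k))
        ≡⟨ sums (shift v (3 * k)) ⟩
      c ∎
    from : IsBijection (m * p) f × IsAntipodal σ f → IsKDML G k f
    from (bij , c , sums) = bij , c , λ u → begin
      sphereSum G k f u                                     ≡⟨ sphereSum-k f u ⟩
      lookup f (shift u k) + lookup f (shift u (3 * k))
        ≡⟨ cong (λ x → lookup f (shift u k) + lookup f x) (shift-+ u k (2 * k)) ⟨
      lookup f (shift u k) + lookup f (σ (shift u k))       ≡⟨ sums (shift u k) ⟩
      c                                                     ∎

  K : ℕ
  K = 2 * k

  p≡K+K : p ≡ K + K
  p≡K+K = double k
    where
    double : ∀ k → 4 * k ≡ 2 * k + 2 * k
    double = solve-∀

  order≡N+N : m * p ≡ m * K + m * K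
  order≡N+N = halves m k
    where
    halves : ∀ m k → m * (4 * k) ≡ m * (2 * k) + m * (2 * k)
    halves = solve-∀

  K<p : K < p
  K<p = subst (K <_) (sym p≡K+K) (m<m+n K (s≤s z≤n))

  K∣p : K ∣ p
  K∣p = divides 2 (trans p≡K+K (cong (K +_) (sym (+-identityʳ K))))

  pos∸K<K : ∀ v → pos v ∸ K < K
  pos∸K<K v = m<n+o⇒m∸n<o (pos v) K (subst (pos v <_) p≡K+K (pos<p v))

  pos%K-≥ : ∀ v → K ≤ pos v → pos v % K ≡ pos v ∸ K
  pos%K-≥ v K≤ = trans (sym (m≤n⇒[n∸m]%m≡n%m K≤)) (m<n⇒m%n≡m (pos∸K<K v))

  pos-σ-< : ∀ v → pos v < K → pos (σ v) ≡ pos v + K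
  pos-σ-< v <K = trans (pos-shift v K) (m<n⇒m%n≡m (subst (pos v + K <_) (sym p≡K+K) (+-monoˡ-< K <K)))

  pos-σ-≥ : ∀ v → K ≤ pos v → pos (σ v) ≡ pos v ∸ K
  pos-σ-≥ v K≤ = begin
    pos (σ v)                ≡⟨ pos-shift v K ⟩
    (pos v + K) % p          ≡⟨ m≤n⇒[n∸m]%m≡n%m p≤ ⟨
    (pos v + K ∸ p) % p      ≡⟨ cong (λ q → (pos v + K ∸ q) % p) p≡K+K ⟩
    (pos v + K ∸ (K + K)) % p ≡⟨ cong (_% p) (∸-+-assoc (pos v + K) K K) ⟨
    (pos v + K ∸ K ∸ K) % p  ≡⟨ cong (λ q → (q ∸ K) % p) (m+n∸n≡m (pos v) K) ⟩
    (pos v ∸ K) % p          ≡⟨ m<n⇒m%n≡m (<-trans (pos∸K<K v) K<p) ⟩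
    pos v ∸ K                ∎
    where
    p≤ : p ≤ pos v + K
    p≤ = subst (_≤ pos v + K) (sym p≡K+K) (+-monoˡ-≤ K K≤)

  side : V → Bool
  side v = ⌊ K ≤? pos v ⌋

  side-≥ : ∀ v → K ≤ pos v → side v ≡ true
  side-≥ v K≤ with K ≤? pos v
  ... | yes _  = refl
  ... | no K≰ = ⊥-elim (K≰ K≤)

  side-< : ∀ v → pos v < K → side v ≡ false
  side-< v <K with K ≤? pos v
  ... | yes K≤ = ⊥-elim (<⇒≱ <K K≤)
  ... | no _   = refl

  lower : V → Fin K
  lower v = fromℕ< (m%n<n (pos v) K)

  orbit : V → Fin (m * K)
  orbit v = combine (copy v) (lower v)

  cell : Fin m → Fin K → V
  cell i r = vertex i (toℕ r)

  pos-cell : ∀ i r → pos (cell i r) ≡ toℕ r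
  pos-cell i r = trans (pos-vertex i (toℕ r)) (m<n⇒m%n≡m (<-trans (toℕ<n r) K<p))

  lower-cell : ∀ i r → lower (cell i r) ≡ r
  lower-cell i r = toℕ-injective
    (trans (toℕ-fromℕ< _) (trans (cong (_% K) (pos-cell i r)) (m<n⇒m%n≡m (toℕ<n r))))

  point : Bool → Fin (m * K) → V
  point false o = cell (proj₁ (remQuot {m} K o)) (proj₂ (remQuot {m} K o))
  point true  o = σ (point false o)

  orbit-σ : ∀ v → orbit (σ v) ≡ orbit v
  orbit-σ v = cong₂ combine (copy-shift v K) (toℕ-injective (begin
    toℕ (lower (σ v))   ≡⟨ toℕ-fromℕ< _ ⟩
    pos (σ v) % K       ≡⟨ cong (_% K) (pos-shift v K) ⟩
    (pos v + K) % p % K ≡⟨ m∣n⇒o%n%m≡o%m K p (pos v + K) K∣p ⟩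
    (pos v + K) % K     ≡⟨ [m+n]%n≡m%n (pos v) K ⟩
    pos v % K           ≡⟨ toℕ-fromℕ< _ ⟨
    toℕ (lower v)       ∎))

  side-σ : ∀ v → side (σ v) ≡ not (side v)
  side-σ v with ≤-<-connex K (pos v)
  ... | inj₁ K≤ = trans (side-< (σ v) (subst (_< K) (sym (pos-σ-≥ v K≤)) (pos∸K<K v)))
                        (cong not (sym (side-≥ v K≤)))
  ... | inj₂ <K = trans (side-≥ (σ v) (subst (K ≤_) (sym (pos-σ-< v <K)) (m≤n+m K (pos v))))
                        (cong not (sym (side-< v <K)))

  orbit-point : ∀ b o → orbit (point b o) ≡ o
  orbit-point false o = trans (cong₂ combine (copy-vertex i (toℕ r)) (lower-cell i r)) (combine-remQuot {m} K o)
    where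
    i = proj₁ (remQuot {m} K o)
    r = proj₂ (remQuot {m} K o)
  orbit-point true o = trans (orbit-σ (point false o)) (orbit-point false o)

  side-point : ∀ b o → side (point b o) ≡ b
  side-point false o = side-< (point false o) (subst (_< K) (sym (pos-cell i r)) (toℕ<n r))
    where
    i = proj₁ (remQuot {m} K o)
    r = proj₂ (remQuot {m} K o)
  side-point true  o = trans (side-σ (point false o)) (cong not (side-point false o))

  base : V → V
  base v = cell (copy v) (lower v)

  copy-base : ∀ v → copy (base v) ≡ copy v
  copy-base v = copy-vertex (copy v) (toℕ (lower v))

  pos-base : ∀ v → pos (base v) ≡ pos v % K
  pos-base v = trans (pos-cell (copy v) (lower v)) (toℕ-fromℕ< _)

  point-false-orbit : ∀ v → point false (orbit v) ≡ base v
  point-false-orbit v = cong₂ cell (cong proj₁ e) (cong proj₂ e)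
    where e = remQuot-combine (copy v) (lower v)

  point-coords : ∀ v → point (side v) (orbit v) ≡ v
  point-coords v with ≤-<-connex K (pos v)
  ... | inj₁ K≤ = begin
    point (side v) (orbit v)   ≡⟨ cong (λ b → point b (orbit v)) (side-≥ v K≤) ⟩
    σ (point false (orbit v))  ≡⟨ cong σ (point-false-orbit v) ⟩
    σ (base v)                 ≡⟨ ≡-by-coords (trans (copy-shift (base v) K) (copy-base v)) pos≡ ⟩
    v                          ∎
    where
    pos≡ : pos (σ (base v)) ≡ pos v
    pos≡ = begin
      pos (σ (base v))        ≡⟨ pos-shift (base v) K ⟩
      (pos (base v) + K) % p  ≡⟨ cong (λ x → (x + K) % p) (trans (pos-base v) (pos%K-≥ v K≤)) ⟩
      (pos v ∸ K + K) % p     ≡⟨ cong (_% p) (m∸n+n≡m K≤) ⟩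
      pos v % p               ≡⟨ pos%p v ⟩
      pos v                   ∎
  ... | inj₂ <K = begin
    point (side v) (orbit v)   ≡⟨ cong (λ b → point b (orbit v)) (side-< v <K) ⟩
    point false (orbit v)      ≡⟨ point-false-orbit v ⟩
    base v                     ≡⟨ ≡-by-coords (copy-base v) (trans (pos-base v) (m<n⇒m%n≡m <K)) ⟩
    v                          ∎

  coordinates : OrbitCoordinates σ (m * K)
  coordinates = record
    { orbit = orbit ; side = side ; point = point
    ; orbit-point = orbit-point ; side-point = side-point ; point-coords = point-coords
    ; orbit-σ = orbit-σ ; side-σ = side-σ }

corollary2p8 : (k m : ℕ) → 1 ≤ k → 1 ≤ m →
    NumKDML (unionCycles m (4 * k)) k (2 ^ (2 * k * m) * (2 * k * m) !)
corollary2p8 (suc k′) (suc m′) _ _ =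
  subst (NumKDML G k) (cong (λ N → 2 ^ N * N !) (*-comm m K))
    (Counted-resp-⇔ antipodal⇔IsKDML
      (antipodalBijections-counted (m * K) order≡N+N (s≤s z≤n) coordinates))
  where open CycleUnion m′ k′
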